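{- Every $\kappa$-vertex-connected ($\kappa \geq 1$) graph $G$ of order $n$ has a connected $2l$-step dominating set of size at most $\left(\frac{2l+1}{\kappa l + 1}\right) n$, for every integer $l \geq 0$.
   Context: All graphs are finite, simple and undirected. A graph is $\kappa$-vertex-connected if its vertex connectivity is at least $\kappa$. For $D \subseteq V(G)$, $d_G(v,D) = \min_{x \in D} d_G(v,x)$. A set $D \subseteq V(G)$ is an $l$-step dominating set of $G$ if every vertex of $G$ is at distance at most $l$ from $D$; it is a connected $l$-step dominating set if moreover the induced subgraph $G[D]$ is connected. -}

module Defs where

open import Data.Nat using (ℕ; zero; suc; _<_)
open import Data.Bool using (Bool; true; false)
open import Data.Fin using (Fin)
open import Data.Fin.Subset using (Subset; _∈_; ∁; ∣_∣)
open import Data.Product using (Σ; ∃; _×_)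
open import Relation.Binary.PropositionalEquality using (_≡_)

record Graph (n : ℕ) : Set where
  field
    adj   : Fin n → Fin n → Bool
    sym   : ∀ u v → adj u v ≡ adj v u
    irrefl : ∀ v → adj v v ≡ false

open Graph public

-- AtMost G k u v : d_G(u,v) ≤ k, i.e. there is a u–v walk of length ≤ k.
data AtMost {n : ℕ} (G : Graph n) : ℕ → Fin n → Fin n → Set where
  here : ∀ {k u} → AtMost G k u u
  step : ∀ {k u w v} → adj G u w ≡ true → AtMost G k w v → AtMost G (suc k) u v

data WalkIn {n : ℕ} (G : Graph n) (S : Subset n) : Fin n → Fin n → Set where
  here : ∀ {u} → u ∈ S → WalkIn G S u u
  step : ∀ {u w v} → u ∈ S → adj G u w ≡ true → WalkIn G S w v → WalkIn G S u v

InducedConnected : {n : ℕ} → Graph n → Subset n → Set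
InducedConnected G S = ∀ u v → u ∈ S → v ∈ S → WalkIn G S u v

KConnected : {n : ℕ} → Graph n → ℕ → Set
KConnected {n} G κ = (κ < n) × (∀ (S : Subset n) → ∣ S ∣ < κ → InducedConnected G (∁ S))

StepDominating : {n : ℕ} → Graph n → ℕ → Subset n → Set
StepDominating {n} G l D = ∀ (v : Fin n) → ∃ λ x → (x ∈ D) × AtMost G l v x

ConnectedStepDominating : {n : ℕ} → Graph n → ℕ → Subset n → Set
ConnectedStepDominating G l D = StepDominating G l D × InducedConnected G D

-- Greedy construction. Maintain a connected set D and a set B of vertices within distance l of D with
-- ∣D∣(κl+1) ≤ (2l+1)∣B∣. While some vertex is farther than 2l from D, following a walk from it to D
-- gives a vertex z at distance exactly 2l+1 from D: add to D the at most 2l+1 new vertices of a walk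
-- of that length from z to D, and add to B the l-ball around z. That ball misses B (else z would be
-- within 2l of D), and since it is not the whole graph, κ-connectivity makes each of its l spheres
-- have at least κ vertices, so it has at least κl+1. When D dominates, ∣B∣ ≤ n gives the bound.
module Submission where

open import Defs
open import Data.Nat using (ℕ; zero; suc; _+_; _*_; _≤_; _<_; z≤n; s≤s)
open import Data.Nat.Properties
  using (≤-trans; ≤-refl; ≤-reflexive; m≤m+n; m≤n+m; +-suc; +-comm; +-identityʳ;
         *-identityˡ; *-zeroʳ; *-distribˡ-+; *-distribʳ-+; +-mono-≤; +-monoˡ-≤; +-monoʳ-≤;
         *-monoˡ-≤; *-monoʳ-≤; ≮⇒≥; n≤1+n; module ≤-Reasoning)
open import Data.Nat.Solver using (module +-*-Solver)
open import Data.Fin using (Fin; fromℕ<)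
open import Data.Fin.Properties using (any?) renaming (_≟_ to _≟ᶠ_)
open import Data.Fin.Subset
open import Data.Fin.Subset.Properties
  using (∉⊥; x∈⁅x⁆; x∈⁅y⁆⇒x≡y; p⊆p∪q; q⊆p∪q; x∈p∪q⁺; x∈p∪q⁻; x∈p∩q⁺; x∈p∩q⁻;
         x∉p⇒x∈∁p; x∈∁p⇒x∉p; ∣p∣≤n; p⊆q⇒∣p∣≤∣q∣; ∣⊤∣≡n; ∣⊥∣≡0; ∣⁅x⁆∣≡1; _∈?_)
open import Data.Fin.Subset.Induction using (Acc; acc; ⊃-wellFounded)
open import Data.Bool using (true; false)
open import Data.Bool.Properties using () renaming (_≟_ to _≟ᵇ_)
open import Data.Vec using ([]; _∷_; tabulate; here; there)
open import Data.Vec.Properties using (lookup∘tabulate; lookup⇒[]=; []=⇒lookup)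
open import Data.Product using (∃; ∃₂; _×_; _,_; proj₁; proj₂)
open import Data.Sum using (_⊎_; inj₁; inj₂)
open import Function using (_∘_)
open import Relation.Nullary using (Dec; yes; no; ¬_; does; contradiction)
open import Relation.Nullary.Decidable using (dec-true; _×-dec_; ¬?; decidable-stable)
open import Relation.Binary.PropositionalEquality
  using (_≡_; refl; cong; subst) renaming (sym to ≡-sym; trans to ≡-trans)

module _ {n : ℕ} where

  fromDec : {P : Fin n → Set} → (∀ x → Dec (P x)) → Subset n
  fromDec P? = tabulate (does ∘ P?)

  ∈-fromDec⁺ : {P : Fin n → Set} (P? : ∀ x → Dec (P x)) {x : Fin n} → P x → x ∈ fromDec P?
  ∈-fromDec⁺ P? {x} px = lookup⇒[]= x _ (≡-trans (lookup∘tabulate _ x) (dec-true (P? x) px))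

  ∈-fromDec⁻ : {P : Fin n → Set} (P? : ∀ x → Dec (P x)) {x : Fin n} → x ∈ fromDec P? → P x
  ∈-fromDec⁻ P? {x} x∈ with P? x | ≡-trans (≡-sym (lookup∘tabulate (does ∘ P?) x)) ([]=⇒lookup x∈)
  ... | yes px | _ = px
  ... | no _   | ()

∣p∪q∣≤∣p∣+∣q∣ : ∀ {n} (p q : Subset n) → ∣ p ∪ q ∣ ≤ ∣ p ∣ + ∣ q ∣
∣p∪q∣≤∣p∣+∣q∣ []          []          = z≤n
∣p∪q∣≤∣p∣+∣q∣ (true ∷ p)  (false ∷ q) = s≤s (∣p∪q∣≤∣p∣+∣q∣ p q)
∣p∪q∣≤∣p∣+∣q∣ (true ∷ p)  (true ∷ q)  = s≤s (≤-trans (∣p∪q∣≤∣p∣+∣q∣ p q) (+-mono-≤ ≤-refl (n≤1+n _)))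
∣p∪q∣≤∣p∣+∣q∣ (false ∷ p) (true ∷ q)  =
  subst (suc ∣ p ∪ q ∣ ≤_) (≡-sym (+-suc ∣ p ∣ ∣ q ∣)) (s≤s (∣p∪q∣≤∣p∣+∣q∣ p q))
∣p∪q∣≤∣p∣+∣q∣ (false ∷ p) (false ∷ q) = ∣p∪q∣≤∣p∣+∣q∣ p q

disjoint⇒∣p∪q∣≡∣p∣+∣q∣ : ∀ {n} (p q : Subset n) → (∀ {x} → x ∈ p → x ∉ q) → ∣ p ∪ q ∣ ≡ ∣ p ∣ + ∣ q ∣
disjoint⇒∣p∪q∣≡∣p∣+∣q∣ []          []          _  = refl
disjoint⇒∣p∪q∣≡∣p∣+∣q∣ (true ∷ p)  (true ∷ q)  dj = contradiction here (dj here)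
disjoint⇒∣p∪q∣≡∣p∣+∣q∣ (true ∷ p)  (false ∷ q) dj =
  cong suc (disjoint⇒∣p∪q∣≡∣p∣+∣q∣ p q λ x∈p x∈q → dj (there x∈p) (there x∈q))
disjoint⇒∣p∪q∣≡∣p∣+∣q∣ (false ∷ p) (true ∷ q)  dj = ≡-trans
  (cong suc (disjoint⇒∣p∪q∣≡∣p∣+∣q∣ p q λ x∈p x∈q → dj (there x∈p) (there x∈q)))
  (≡-sym (+-suc ∣ p ∣ ∣ q ∣))
disjoint⇒∣p∪q∣≡∣p∣+∣q∣ (false ∷ p) (false ∷ q) dj =
  disjoint⇒∣p∪q∣≡∣p∣+∣q∣ p q λ x∈p x∈q → dj (there x∈p) (there x∈q)

module Walks {n : ℕ} (G : Graph n) where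

  adj-sym : ∀ {u v} → adj G u v ≡ true → adj G v u ≡ true
  adj-sym {u} {v} = ≡-trans (Defs.sym G v u)

  atMost-mono : ∀ {j k u v} → j ≤ k → AtMost G j u v → AtMost G k u v
  atMost-mono _         here       = here
  atMost-mono (s≤s j≤k) (step e p) = step e (atMost-mono j≤k p)

  atMost-++ : ∀ {j k u w v} → AtMost G j u w → AtMost G k w v → AtMost G (j + k) u v
  atMost-++ {j} {k} here q = atMost-mono (m≤n+m k j) q
  atMost-++ (step e p) q   = step e (atMost-++ p q)

  atMost-snoc : ∀ {k u w v} → AtMost G k u w → adj G w v ≡ true → AtMost G (suc k) u v
  atMost-snoc here       e = step e here
  atMost-snoc (step f p) e = step f (atMost-snoc p e)

  atMost-sym : ∀ {k u v} → AtMost G k u v → AtMost G k v u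
  atMost-sym here       = here
  atMost-sym (step e p) = atMost-snoc (atMost-sym p) (adj-sym e)

  atMost? : ∀ k u v → Dec (AtMost G k u v)
  atMost? k u v with u ≟ᶠ v
  atMost? k       u u | yes refl = yes here
  atMost? zero    u v | no u≢v = no λ { here → u≢v refl }
  atMost? (suc k) u v | no u≢v with any? (λ w → (adj G u w ≟ᵇ true) ×-dec atMost? k w v)
  ... | yes (w , e , p) = yes (step e p)
  ... | no ∄w           = no λ { here → u≢v refl ; (step e p) → ∄w (_ , e , p) }

  walkIn-mono : ∀ {S T u v} → S ⊆ T → WalkIn G S u v → WalkIn G T u v
  walkIn-mono S⊆T (here u∈S)     = here (S⊆T u∈S)
  walkIn-mono S⊆T (step u∈S e p) = step (S⊆T u∈S) e (walkIn-mono S⊆T p)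

  walkIn-++ : ∀ {S u w v} → WalkIn G S u w → WalkIn G S w v → WalkIn G S u v
  walkIn-++ (here _)       q = q
  walkIn-++ (step u∈S e p) q = step u∈S e (walkIn-++ p q)

  walkIn-snoc : ∀ {S u w v} → WalkIn G S u w → adj G w v ≡ true → v ∈ S → WalkIn G S u v
  walkIn-snoc (here w∈S)     e v∈S = step w∈S e (here v∈S)
  walkIn-snoc (step u∈S f p) e v∈S = step u∈S f (walkIn-snoc p e v∈S)

  walkIn-sym : ∀ {S u v} → WalkIn G S u v → WalkIn G S v u
  walkIn-sym (here u∈S)     = here u∈S
  walkIn-sym (step u∈S e p) = walkIn-snoc (walkIn-sym p) (adj-sym e) u∈S

  connected-via : ∀ {S} x → (∀ a → a ∈ S → WalkIn G S a x) → InducedConnected G S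
  connected-via x toX a b a∈S b∈S = walkIn-++ (toX a a∈S) (walkIn-sym (toX b b∈S))

  crossing-edge : ∀ {S u v} {P : Fin n → Set} → (∀ x → Dec (P x)) →
                  WalkIn G S u v → ¬ P u → P v →
                  ∃₂ λ z w → z ∈ S × adj G z w ≡ true × ¬ P z × P w
  crossing-edge P? (here _)               ¬Pu Pv = contradiction Pv ¬Pu
  crossing-edge P? (step {w = w} u∈S e p) ¬Pu Pv with P? w
  ... | yes Pw = _ , w , u∈S , e , ¬Pu , Pw
  ... | no ¬Pw = crossing-edge P? p ¬Pw Pv

  support : ∀ {k u v} → AtMost G k u v → Subset n
  support here               = ⊥
  support (step {u = u} _ p) = ⁅ u ⁆ ∪ support p

  ∣support∣≤length : ∀ {k u v} (p : AtMost G k u v) → ∣ support p ∣ ≤ k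
  ∣support∣≤length here = subst (_≤ _) (≡-sym (∣⊥∣≡0 n)) z≤n
  ∣support∣≤length (step {u = u} _ p) = ≤-trans (∣p∪q∣≤∣p∣+∣q∣ ⁅ u ⁆ (support p))
    (subst (λ s → s + ∣ support p ∣ ≤ _) (≡-sym (∣⁅x⁆∣≡1 u)) (s≤s (∣support∣≤length p)))

  atMost⇒walkIn : ∀ {S k u v} (p : AtMost G k u v) → support p ⊆ S → v ∈ S → WalkIn G S u v
  atMost⇒walkIn here _ v∈S = here v∈S
  atMost⇒walkIn (step {u = u} e p) sp⊆S v∈S =
    step (sp⊆S (x∈p∪q⁺ (inj₁ (x∈⁅x⁆ u)))) e (atMost⇒walkIn p (sp⊆S ∘ q⊆p∪q ⁅ u ⁆ (support p)) v∈S)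

  support-walkIn : ∀ {S k u v} (p : AtMost G k u v) → support p ⊆ S → v ∈ S →
                   ∀ a → a ∈ support p → WalkIn G S a v
  support-walkIn here _ _ a a∈⊥ = contradiction a∈⊥ ∉⊥
  support-walkIn (step {u = u} e p) sp⊆S v∈S a a∈sp with x∈p∪q⁻ ⁅ u ⁆ (support p) a∈sp
  ... | inj₁ a∈⁅u⁆ rewrite x∈⁅y⁆⇒x≡y u a∈⁅u⁆ = atMost⇒walkIn (step e p) sp⊆S v∈S
  ... | inj₂ a∈sp′ = support-walkIn p (sp⊆S ∘ q⊆p∪q ⁅ u ⁆ (support p)) v∈S a a∈sp′

  connected-∪-support : ∀ {D k u x} → InducedConnected G D → (p : AtMost G k u x) → x ∈ D →
                        InducedConnected G (D ∪ support p)
  connected-∪-support {D} conn p x∈D = connected-via _ toX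
    where
    toX : ∀ a → a ∈ D ∪ support p → WalkIn G (D ∪ support p) a _
    toX a a∈ with x∈p∪q⁻ D (support p) a∈
    ... | inj₁ a∈D  = walkIn-mono (p⊆p∪q (support p)) (conn a _ a∈D x∈D)
    ... | inj₂ a∈sp = support-walkIn p (q⊆p∪q D (support p)) (p⊆p∪q (support p) x∈D) a a∈sp

  ball : ℕ → Fin n → Subset n
  ball i c = fromDec (λ u → atMost? i u c)

  ∈-ball⁺ : ∀ {i c u} → AtMost G i u c → u ∈ ball i c
  ∈-ball⁺ {i} {c} = ∈-fromDec⁺ (λ u → atMost? i u c)

  ∈-ball⁻ : ∀ {i c u} → u ∈ ball i c → AtMost G i u c
  ∈-ball⁻ {i} {c} = ∈-fromDec⁻ (λ u → atMost? i u c)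

  ball-mono : ∀ {i c} → ball i c ⊆ ball (suc i) c
  ball-mono = ∈-ball⁺ ∘ atMost-mono (n≤1+n _) ∘ ∈-ball⁻

  sphere : ℕ → Fin n → Subset n
  sphere i c = ball (suc i) c ∩ ∁ (ball i c)

  Near : ℕ → Subset n → Fin n → Set
  Near k D y = ∃ λ x → x ∈ D × AtMost G k y x

  near? : ∀ k D y → Dec (Near k D y)
  near? k D y = any? (λ x → (x ∈? D) ×-dec atMost? k y x)

module KConnectivity {n : ℕ} (G : Graph n) (κ : ℕ) (kc : KConnected G κ) where
  open Walks G

  κ≤∣sphere∣ : ∀ i c {y} → y ∉ ball (suc i) c → κ ≤ ∣ sphere i c ∣
  κ≤∣sphere∣ i c {y} y∉ = ≮⇒≥ λ small → sphere-separates (proj₂ kc (sphere i c) small y c y∉S c∉S)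
    where
    y∉S : y ∈ ∁ (sphere i c)
    y∉S = x∉p⇒x∈∁p (y∉ ∘ proj₁ ∘ x∈p∩q⁻ _ _)
    c∉S : c ∈ ∁ (sphere i c)
    c∉S = x∉p⇒x∈∁p λ c∈S → x∈∁p⇒x∉p (proj₂ (x∈p∩q⁻ _ _ c∈S)) (∈-ball⁺ here)
    sphere-separates : ¬ WalkIn G (∁ (sphere i c)) y c
    sphere-separates walk with crossing-edge (_∈? ball i c) walk (y∉ ∘ ball-mono) (∈-ball⁺ here)
    ... | z , w , z∉S , e , z∉ball , w∈ball =
      x∈∁p⇒x∉p z∉S (x∈p∩q⁺ (∈-ball⁺ (step e (∈-ball⁻ w∈ball)) , x∉p⇒x∈∁p z∉ball))

  ⁅c⁆⊆ball : ∀ i c → ⁅ c ⁆ ⊆ ball i c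
  ⁅c⁆⊆ball i c x∈ rewrite x∈⁅y⁆⇒x≡y c x∈ = ∈-ball⁺ here

  ball-size : ∀ i c {y} → y ∉ ball i c → κ * i + 1 ≤ ∣ ball i c ∣
  ball-size zero c _ = begin
    κ * 0 + 1       ≡⟨ cong (_+ 1) (*-zeroʳ κ) ⟩
    1               ≡⟨ ∣⁅x⁆∣≡1 c ⟨
    ∣ ⁅ c ⁆ ∣       ≤⟨ p⊆q⇒∣p∣≤∣q∣ (⁅c⁆⊆ball 0 c) ⟩
    ∣ ball 0 c ∣    ∎
    where open ≤-Reasoning
  ball-size (suc i) c y∉ = begin
    κ * suc i + 1                       ≡⟨ solve 2 (λ k i → k :* (con 1 :+ i) :+ con 1 := k :* i :+ con 1 :+ k)
                                                 refl κ i ⟩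
    κ * i + 1 + κ                       ≤⟨ +-mono-≤ (ball-size i c (y∉ ∘ ball-mono)) (κ≤∣sphere∣ i c y∉) ⟩
    ∣ ball i c ∣ + ∣ sphere i c ∣       ≡⟨ disjoint⇒∣p∪q∣≡∣p∣+∣q∣ (ball i c) (sphere i c) disjoint ⟨
    ∣ ball i c ∪ sphere i c ∣           ≤⟨ p⊆q⇒∣p∣≤∣q∣ ∪⊆ball ⟩
    ∣ ball (suc i) c ∣                  ∎
    where
    open ≤-Reasoning
    open +-*-Solver
    disjoint : ∀ {x} → x ∈ ball i c → x ∉ sphere i c
    disjoint x∈B x∈S = x∈∁p⇒x∉p (proj₂ (x∈p∩q⁻ _ _ x∈S)) x∈B
    ∪⊆ball : ball i c ∪ sphere i c ⊆ ball (suc i) c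
    ∪⊆ball x∈ with x∈p∪q⁻ (ball i c) (sphere i c) x∈
    ... | inj₁ x∈B = ball-mono x∈B
    ... | inj₂ x∈S = proj₁ (x∈p∩q⁻ _ _ x∈S)

  walk : 1 ≤ κ → ∀ u v → WalkIn G (∁ ⊥) u v
  walk 1≤κ u v = proj₂ kc ⊥ (subst (_< κ) (≡-sym (∣⊥∣≡0 n)) 1≤κ) u v (x∉p⇒x∈∁p ∉⊥) (x∉p⇒x∈∁p ∉⊥)

bound-step : ∀ {d d′ b b′ z k m} → d * k ≤ m * b → d′ ≤ d + m → k ≤ z → b + z ≤ b′ → d′ * k ≤ m * b′
bound-step {d} {d′} {b} {b′} {z} {k} {m} dk≤mb d′≤ k≤z b+z≤ = begin
  d′ * k            ≤⟨ *-monoˡ-≤ k d′≤ ⟩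
  (d + m) * k       ≡⟨ *-distribʳ-+ k d m ⟩
  d * k + m * k     ≤⟨ +-mono-≤ dk≤mb (*-monoʳ-≤ m k≤z) ⟩
  m * b + m * z     ≡⟨ *-distribˡ-+ m b z ⟨
  m * (b + z)       ≤⟨ *-monoʳ-≤ m b+z≤ ⟩
  m * b′            ∎
  where open ≤-Reasoning

κl+1≤[2l+1]n : ∀ {κ n} l → κ < n → κ * l + 1 ≤ (2 * l + 1) * n
κl+1≤[2l+1]n {κ} {n} l κ<n = begin
  κ * l + 1         ≤⟨ +-mono-≤ (*-monoˡ-≤ l (≤-trans (n≤1+n κ) κ<n)) (≤-trans (s≤s z≤n) κ<n) ⟩
  n * l + n         ≡⟨ solve 2 (λ n l → n :* l :+ n := (l :+ con 1) :* n) refl n l ⟩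
  (l + 1) * n       ≤⟨ *-monoˡ-≤ n (+-monoˡ-≤ 1 (m≤m+n l (l + 0))) ⟩
  (2 * l + 1) * n   ∎
  where
  open ≤-Reasoning
  open +-*-Solver

module Greedy {n : ℕ} (G : Graph n) (κ : ℕ) (kc : KConnected G κ) (l : ℕ) where
  open Walks G
  open KConnectivity G κ kc

  record Invariant (D B : Subset n) : Set where
    field
      inhabited : ∃ λ x → x ∈ D
      connected : InducedConnected G D
      covered   : ∀ u → u ∈ B → Near l D u
      bound     : ∣ D ∣ * (κ * l + 1) ≤ (2 * l + 1) * ∣ B ∣

  far⇒ball-far : ∀ {D z a} → ¬ Near (2 * l) D z → a ∈ ball l z → ¬ Near l D a
  far⇒ball-far ¬near a∈ (e , e∈D , q) =
    ¬near (e , e∈D , atMost-mono l+l≤2l (atMost-++ (atMost-sym (∈-ball⁻ a∈)) q))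
    where
    l+l≤2l : l + l ≤ 2 * l
    l+l≤2l = ≤-reflexive (cong (l +_) (≡-sym (+-identityʳ l)))

  extend : ∀ {D B z w} → Invariant D B → ¬ Near (2 * l) D z → adj G z w ≡ true → Near (2 * l) D w →
           ∃₂ λ D′ B′ → Invariant D′ B′ × D ⊂ D′
  extend {D} {B} {z} inv ¬near e (x , x∈D , q) =
    D ∪ support p , B ∪ ball l z , inv′ , p⊆p∪q (support p) , z , z∈D′ , ¬near ∘ (λ z∈D → z , z∈D , here)
    where
    open Invariant inv
    p : AtMost G (suc (2 * l)) z x
    p = step e q
    z∈D′ : z ∈ D ∪ support p
    z∈D′ = x∈p∪q⁺ (inj₂ (x∈p∪q⁺ (inj₁ (x∈⁅x⁆ z))))
    ∣D′∣≤ : ∣ D ∪ support p ∣ ≤ ∣ D ∣ + (2 * l + 1)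
    ∣D′∣≤ = ≤-trans (∣p∪q∣≤∣p∣+∣q∣ D (support p))
                    (+-monoʳ-≤ ∣ D ∣ (subst (∣ support p ∣ ≤_) (+-comm 1 (2 * l)) (∣support∣≤length p)))
    x∉ball : x ∉ ball l z
    x∉ball x∈ = far⇒ball-far ¬near x∈ (x , x∈D , here)
    ∣B′∣≡ : ∣ B ∪ ball l z ∣ ≡ ∣ B ∣ + ∣ ball l z ∣
    ∣B′∣≡ = disjoint⇒∣p∪q∣≡∣p∣+∣q∣ B (ball l z) λ {u} u∈B u∈ → far⇒ball-far ¬near u∈ (covered u u∈B)
    covered′ : ∀ u → u ∈ B ⊎ u ∈ ball l z → Near l (D ∪ support p) u
    covered′ u (inj₁ u∈B) with covered u u∈B
    ... | d , d∈D , r = d , p⊆p∪q (support p) d∈D , r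
    covered′ u (inj₂ u∈ball) = z , z∈D′ , ∈-ball⁻ u∈ball
    inv′ : Invariant (D ∪ support p) (B ∪ ball l z)
    inv′ = record
      { inhabited = x , p⊆p∪q (support p) x∈D
      ; connected = connected-∪-support connected p x∈D
      ; covered   = λ u → covered′ u ∘ x∈p∪q⁻ B (ball l z)
      ; bound     = bound-step {d = ∣ D ∣} {m = 2 * l + 1} bound ∣D′∣≤ (ball-size l z x∉ball)
                               (≤-reflexive (≡-sym ∣B′∣≡))
      }

  initial : ∀ v → Invariant ⁅ v ⁆ (ball l v)
  initial v = record
    { inhabited = v , x∈⁅x⁆ v
    ; connected = connected-via v λ a a∈ →
                    subst (λ t → WalkIn G ⁅ v ⁆ t v) (≡-sym (x∈⁅y⁆⇒x≡y v a∈)) (here (x∈⁅x⁆ v))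
    ; covered   = λ u u∈ → v , x∈⁅x⁆ v , ∈-ball⁻ u∈
    ; bound     = subst (λ s → s * (κ * l + 1) ≤ (2 * l + 1) * ∣ ball l v ∣) (≡-sym (∣⁅x⁆∣≡1 v))
                    (≤-trans (≤-reflexive (*-identityˡ _)) κl+1≤)
    }
    where
    κl+1≤ : κ * l + 1 ≤ (2 * l + 1) * ∣ ball l v ∣
    κl+1≤ with any? (λ y → ¬? (y ∈? ball l v))
    ... | yes (y , y∉) = ≤-trans (ball-size l v y∉)
                           (subst (λ s → ∣ ball l v ∣ ≤ s * ∣ ball l v ∣) (+-comm 1 (2 * l)) (m≤m+n _ _))
    ... | no ∄y = ≤-trans (κl+1≤[2l+1]n l (proj₁ kc)) (*-monoʳ-≤ (2 * l + 1) n≤∣ball∣)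
      where
      n≤∣ball∣ : n ≤ ∣ ball l v ∣
      n≤∣ball∣ = subst (_≤ ∣ ball l v ∣) (∣⊤∣≡n n)
                   (p⊆q⇒∣p∣≤∣q∣ {p = ⊤} λ {y} _ → decidable-stable (y ∈? ball l v) (∄y ∘ (y ,_)))

  Result : Set
  Result = ∃ λ D → ConnectedStepDominating G (2 * l) D × ∣ D ∣ * (κ * l + 1) ≤ (2 * l + 1) * n

  grow : 1 ≤ κ → ∀ {D B} → Acc _⊃_ D → Invariant D B → Result
  grow 1≤κ {D} {B} (acc rs) inv with any? (¬? ∘ near? (2 * l) D)
  ... | no ∄far = D , (dominating , connected) , ≤-trans bound (*-monoʳ-≤ (2 * l + 1) (∣p∣≤n B))
    where
    open Invariant inv
    dominating : StepDominating G (2 * l) D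
    dominating y = decidable-stable (near? (2 * l) D y) (∄far ∘ (y ,_))
  ... | yes (y , far) with Invariant.inhabited inv
  ... | x , x∈D with crossing-edge (near? (2 * l) D) (walk 1≤κ y x) far (x , x∈D , here)
  ... | z , w , _ , e , ¬near , near with extend inv ¬near e near
  ... | D′ , B′ , inv′ , D⊂D′ = grow 1≤κ (rs D⊂D′) inv′

lemma3 : ∀ {n : ℕ} (G : Graph n) (κ : ℕ) → 1 ≤ κ → KConnected G κ →
           ∀ (l : ℕ) → ∃ λ (D : Subset n) →
             ConnectedStepDominating G (2 * l) D × ∣ D ∣ * (κ * l + 1) ≤ (2 * l + 1) * n
lemma3 {n} G κ 1≤κ kc l = grow 1≤κ (⊃-wellFounded ⁅ v ⁆) (initial v)
  where
  open Greedy G κ kc l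
  v : Fin n
  v = fromℕ< (≤-trans (s≤s z≤n) (proj₁ kc))
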